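{- Let $l\geq 2$, let $a_1,\dots,a_l\geq 3$ and $1\leq k<\min\{a_1,\dots,a_l\}$ be integers, and let $G=K_{a_{1}}\circ_{k}K_{a_{2}}\circ_{k}\cdots\circ_{k}K_{a_{l}}$. Then the spectrum of $\epsilon(G)$ consists of: (1) $-1$ with multiplicity at least $k-1$; (2) $0$ with multiplicity at least $(a_{1}-k-1)+(a_{2}-k-1)+\cdots+(a_{l}-k-1)$; (3) the eigenvalues of the $(l+1)\times(l+1)$ matrix $$\begin{pmatrix} k-1& a_{1}-k & a_{2}-k &\cdots &a_{l}-k \\ k & 0 & 2(a_{2}-k) &\cdots &2(a_{l}-k)\\ k & 2(a_{1}-k) &0 &\cdots&2(a_{l}-k)\\ \vdots&\vdots&\vdots &\ddots&\vdots\\ k&2(a_{1}-k)&2(a_{2}-k)&\cdots&0 \end{pmatrix},$$ whose $(i+1,j+1)$ entry for $1\le i,j\le l$ is $0$ if $i=j$ and $2(a_j-k)$ if $i\ne j$.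
   Context: All graphs are finite, simple and connected. $d(u,v)$ is the distance and $e(v)=\max_u d(u,v)$ the eccentricity of $v$. The eccentricity matrix $\epsilon(G)$ is indexed by $V(G)$ with $(u,v)$ entry $d(u,v)$ if $d(u,v)=\min\{e(u),e(v)\}$ and $0$ otherwise. The graph $K_{a_{1}}\circ_{k}\cdots\circ_{k}K_{a_{l}}$ ($k$-coalescence) is obtained from disjoint complete graphs $K_{a_1},\dots,K_{a_l}$ by choosing an induced $K_k$ in each and identifying these copies of $K_k$ vertex by vertex; equivalently its vertex set is a disjoint union $C\cup P_1\cup\cdots\cup P_l$ with $|C|=k$, $|P_i|=a_i-k$, each $C\cup P_i$ induces a complete graph, and there are no edges between $P_i$ and $P_j$ for $i\ne j$. -}

module Defs where

open import Data.Nat as ℕ using (ℕ; zero; suc; _∸_; _⊔_; _⊓_)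
open import Data.Integer as ℤ using (ℤ; +_; _-_; _*_; -_)
open import Data.Fin as Fin using (Fin; zero; suc; toℕ; punchIn)
open import Data.Bool using (Bool; true; false; _∧_; _∨_; not; if_then_else_)
open import Data.List using (List; allFin)
open import Data.Bool.ListAction using (any)
open import Data.Sum using (_⊎_; inj₁; inj₂)
open import Data.Product using (Σ; _,_)
open import Relation.Nullary.Decidable using (⌊_⌋)

reach : ∀ {n} → (Fin n → Fin n → Bool) → ℕ → Fin n → Fin n → Bool
reach adj zero    u v = ⌊ u Fin.≟ v ⌋
reach {n} adj (suc m) u v =
  reach adj m u v ∨ any (λ w → reach adj m u w ∧ adj w v) (allFin n)

-- least m in [start, start+fuel) with p m, or start+fuel if none
minFrom : (ℕ → Bool) → ℕ → ℕ → ℕ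
minFrom p m zero    = m
minFrom p m (suc f) = if p m then m else minFrom p (suc m) f

-- graph distance d(u,v) (correct for connected graphs: d(u,v) ≤ n - 1)
dist : ∀ {n} → (Fin n → Fin n → Bool) → Fin n → Fin n → ℕ
dist {n} adj u v = minFrom (λ m → reach adj m u v) 0 n

maxFin : ∀ {n} → (Fin n → ℕ) → ℕ
maxFin {zero}  f = 0
maxFin {suc n} f = f zero ⊔ maxFin (λ i → f (suc i))

ecc : ∀ {n} → (Fin n → Fin n → Bool) → Fin n → ℕ
ecc adj v = maxFin (λ u → dist adj u v)

eccMatrix : ∀ {n} → (Fin n → Fin n → Bool) → Fin n → Fin n → ℤ
eccMatrix adj u v =
  if ⌊ dist adj u v ℕ.≟ (ecc adj u ⊓ ecc adj v) ⌋ then + dist adj u v else + 0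

sumFin : ∀ {n} → (Fin n → ℤ) → ℤ
sumFin {zero}  f = + 0
sumFin {suc n} f = f zero ℤ.+ sumFin (λ i → f (suc i))

sign : ℕ → ℤ
sign zero          = + 1
sign (suc zero)    = - (+ 1)
sign (suc (suc m)) = sign m

det : ∀ {n} → (Fin n → Fin n → ℤ) → ℤ
det {zero}  M = + 1
det {suc n} M =
  sumFin (λ j → sign (toℕ j) * (M zero j * det (λ r c → M (suc r) (punchIn j c))))

charPolyAt : ∀ {n} → (Fin n → Fin n → ℤ) → ℤ → ℤ
charPolyAt A t = det (λ u v → (if ⌊ u Fin.≟ v ⌋ then t else + 0) - A u v)

-- The k-coalescence K_{a_1} ∘_k ... ∘_k K_{a_l}:
-- vertex set C ⊎ P_1 ⊎ ... ⊎ P_l with |C| = k, |P_i| = a_i - k.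

CoalVertex : (k l : ℕ) → (Fin l → ℕ) → Set
CoalVertex k l a = Fin k ⊎ Σ (Fin l) (λ i → Fin (a i ∸ k))

coalAdj : ∀ {k l a} → CoalVertex k l a → CoalVertex k l a → Bool
coalAdj (inj₁ x) (inj₁ y) = not ⌊ x Fin.≟ y ⌋
coalAdj (inj₁ x) (inj₂ y) = true
coalAdj (inj₂ x) (inj₁ y) = true
coalAdj (inj₂ (i , x)) (inj₂ (j , y)) =
  ⌊ i Fin.≟ j ⌋ ∧ not ⌊ toℕ x ℕ.≟ toℕ y ⌋

quotMatrix : (k l : ℕ) → (Fin l → ℕ) → Fin (suc l) → Fin (suc l) → ℤ
quotMatrix k l a zero    zero    = + (k ∸ 1)
quotMatrix k l a zero    (suc j) = + (a j ∸ k)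
quotMatrix k l a (suc i) zero    = + k
quotMatrix k l a (suc i) (suc j) =
  if ⌊ i Fin.≟ j ⌋ then + 0 else + (2 ℕ.* (a j ∸ k))

sumℕ : ∀ {l} → (Fin l → ℕ) → ℕ
sumℕ {zero}  f = 0
sumℕ {suc l} f = f zero ℕ.+ sumℕ (λ i → f (suc i))

-- In G every vertex of C is adjacent to all others, two vertices of one P i are adjacent, and vertices of
-- different P i, P j are at distance 2 (through C).  So e = 1 on C and e = 2 on each P i, and the entry
-- (u, v) of ε(G) off the diagonal depends only on the parts of u and v; it is 0 inside a P i.  Hence
-- tI − ε(G) = D − B W, where D is diagonal with entry t + 1 on C and t on the P i, B is constant on the
-- blocks of the partition C, P 1, …, P l, and W is the identity.
-- For matrices of this form, subtracting the row of a vertex from the row of another vertex of the same part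
-- leaves a row d (e_u − e_v); expanding along it and adding the two resulting columns merges the two vertices
-- into one whose weight in W is the sum of theirs, at the cost of the factor d.  Merging each part into a
-- single vertex extracts (t + 1)^(k − 1) t^(Σ (a i − k − 1)) and leaves tI minus the quotient matrix.

module Submission where

open import Defs
open import Data.Nat as ℕ using (ℕ; zero; suc; _∸_; _⊔_; _⊓_; _≤_; _<_; s≤s; z≤n)
import Data.Nat.Properties as ℕP
open import Data.Integer as ℤ using (ℤ; +_; _+_; _*_; -_; _-_; _^_)
import Data.Integer.Properties as ℤP
open import Data.Integer.Tactic.RingSolver using (solve-∀)
open import Data.Fin as Fin using (Fin; zero; suc; punchIn; punchOut; toℕ)
open import Data.Fin.Properties
  using (punchOut-punchIn; punchIn-punchOut; punchOut-injective; punchInᵢ≢i; suc-injective;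
         punchOut-cong; any?; cantor-schröder-bernstein; toℕ-injective)
open import Data.Fin.Permutation as Perm using (Permutation′; _⟨$⟩ʳ_; _⟨$⟩ˡ_)
open import Data.List as List using (List; []; _∷_; _++_; tabulate)
open import Data.Bool using (Bool; true; false; if_then_else_; _∧_; not)
open import Data.Bool.Properties using (∨-zeroʳ)
open import Data.Bool.ListAction using (any)
open import Data.Sum using (inj₁; inj₂)
open import Data.Product using (Σ; _,_; proj₁; proj₂; _×_)
open import Data.Empty using (⊥-elim)
open import Function using (_∘_; id; _↔_; Inverse; Injective)
open import Function.Properties.Inverse using (↔⇒↣)
open import Function.Bundles using (Injection)
open import Relation.Nullary using (¬_; yes; no; Dec)
open import Relation.Nullary.Decidable using (⌊_⌋; _×-dec_; ¬?)
open import Relation.Binary.PropositionalEquality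

-- Finite sums and products

sumFin-cong : ∀ {n} {f g : Fin n → ℤ} → (∀ i → f i ≡ g i) → sumFin f ≡ sumFin g
sumFin-cong {zero}  f≗g = refl
sumFin-cong {suc n} f≗g = cong₂ _+_ (f≗g zero) (sumFin-cong (f≗g ∘ suc))

sumFin-zero : ∀ {n} (f : Fin n → ℤ) → (∀ i → f i ≡ + 0) → sumFin f ≡ + 0
sumFin-zero {zero}  f f≗0 = refl
sumFin-zero {suc n} f f≗0 = cong₂ _+_ (f≗0 zero) (sumFin-zero (f ∘ suc) (f≗0 ∘ suc))

sumFin-distrib-+ : ∀ {n} (f g : Fin n → ℤ) → sumFin (λ i → f i + g i) ≡ sumFin f + sumFin g
sumFin-distrib-+ {zero}  f g = refl
sumFin-distrib-+ {suc n} f g =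
  trans (cong (_+_ (f zero + g zero)) (sumFin-distrib-+ (f ∘ suc) (g ∘ suc)))
        (interchange (f zero) (g zero) (sumFin (f ∘ suc)) (sumFin (g ∘ suc)))
  where
  interchange : ∀ a b c d → a + b + (c + d) ≡ a + c + (b + d)
  interchange = solve-∀

*-distribˡ-sumFin : ∀ {n} x (f : Fin n → ℤ) → x * sumFin f ≡ sumFin (λ i → x * f i)
*-distribˡ-sumFin {zero}  x f = ℤP.*-zeroʳ x
*-distribˡ-sumFin {suc n} x f =
  trans (ℤP.*-distribˡ-+ x (f zero) _) (cong (_+_ (x * f zero)) (*-distribˡ-sumFin x (f ∘ suc)))

neg-distrib-sumFin : ∀ {n} (f : Fin n → ℤ) → - sumFin f ≡ sumFin (λ i → - f i)
neg-distrib-sumFin {zero}  f = refl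
neg-distrib-sumFin {suc n} f =
  trans (ℤP.neg-distrib-+ (f zero) _) (cong (_+_ (- f zero)) (neg-distrib-sumFin (f ∘ suc)))

sumFin-single : ∀ {n} (f : Fin n → ℤ) i → (∀ j → j ≢ i → f j ≡ + 0) → sumFin f ≡ f i
sumFin-single {suc n} f zero f≗0 =
  trans (cong (_+_ (f zero)) (sumFin-zero (f ∘ suc) (λ j → f≗0 (suc j) λ ()))) (ℤP.+-identityʳ _)
sumFin-single {suc n} f (suc i) f≗0 =
  trans (cong₂ _+_ (f≗0 zero λ ())
                   (sumFin-single (f ∘ suc) i (λ j j≢i → f≗0 (suc j) (j≢i ∘ suc-injective))))
        (ℤP.+-identityˡ _)

sumFin-comm : ∀ {m n} (f : Fin m → Fin n → ℤ) →
  sumFin (λ i → sumFin (f i)) ≡ sumFin (λ j → sumFin (λ i → f i j))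
sumFin-comm {zero} {n} f = sym (sumFin-zero {n} _ (λ _ → refl))
sumFin-comm {suc m} f =
  trans (cong (_+_ (sumFin (f zero))) (sumFin-comm (f ∘ suc)))
        (sym (sumFin-distrib-+ (f zero) (λ j → sumFin (λ i → f (suc i) j))))

sumFin-punchIn : ∀ {n} (f : Fin (suc n) → ℤ) i → sumFin f ≡ f i + sumFin (f ∘ punchIn i)
sumFin-punchIn f zero = refl
sumFin-punchIn {suc n} f (suc i) =
  trans (cong (_+_ (f zero)) (sumFin-punchIn (f ∘ suc) i)) (left-comm (f zero) (f (suc i)) _)
  where
  left-comm : ∀ x y z → x + (y + z) ≡ y + (x + z)
  left-comm = solve-∀

+-sumℕ : ∀ {n} (f : Fin n → ℕ) → + sumℕ f ≡ sumFin (λ i → + f i)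
+-sumℕ {zero}  f = refl
+-sumℕ {suc n} f = cong (_+_ (+ f zero)) (+-sumℕ (f ∘ suc))

prodFin : ∀ {n} → (Fin n → ℤ) → ℤ
prodFin {zero}  f = + 1
prodFin {suc n} f = f zero * prodFin (f ∘ suc)

prodFin-cong : ∀ {n} {f g : Fin n → ℤ} → (∀ i → f i ≡ g i) → prodFin f ≡ prodFin g
prodFin-cong {zero}  f≗g = refl
prodFin-cong {suc n} f≗g = cong₂ _*_ (f≗g zero) (prodFin-cong (f≗g ∘ suc))

prodFin-one : ∀ {n} (f : Fin n → ℤ) → (∀ i → f i ≡ + 1) → prodFin f ≡ + 1
prodFin-one {zero}  f f≗1 = refl
prodFin-one {suc n} f f≗1 = cong₂ _*_ (f≗1 zero) (prodFin-one (f ∘ suc) (f≗1 ∘ suc))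

prodFin-scaleAt : ∀ {n} (f g : Fin n → ℤ) i x →
  (∀ j → j ≢ i → f j ≡ g j) → f i ≡ x * g i → prodFin f ≡ x * prodFin g
prodFin-scaleAt {suc n} f g zero x f≗g fi =
  trans (cong₂ _*_ fi (prodFin-cong (λ j → f≗g (suc j) λ ()))) (ℤP.*-assoc x (g zero) _)
prodFin-scaleAt {suc n} f g (suc i) x f≗g fi =
  trans (cong₂ _*_ (f≗g zero λ ())
                   (prodFin-scaleAt (f ∘ suc) (g ∘ suc) i x
                      (λ j j≢i → f≗g (suc j) (j≢i ∘ suc-injective)) fi))
        (left-comm (g zero) x (prodFin (g ∘ suc)))
  where
  left-comm : ∀ a b c → a * (b * c) ≡ b * (a * c)
  left-comm = solve-∀

prodFin-pow : ∀ {n} x (f : Fin n → ℕ) → prodFin (λ i → x ^ f i) ≡ x ^ sumℕ f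
prodFin-pow {zero}  x f = refl
prodFin-pow {suc n} x f =
  trans (cong (x ^ f zero *_) (prodFin-pow x (f ∘ suc))) (sym (ℤP.^-distribˡ-+-* x (f zero) (sumℕ (f ∘ suc))))

-- Adjacent transpositions

swapAdj : ∀ {n} → Fin n → Fin (suc n) → Fin (suc n)
swapAdj zero    zero          = suc zero
swapAdj zero    (suc zero)    = zero
swapAdj zero    (suc (suc x)) = suc (suc x)
swapAdj (suc i) zero          = zero
swapAdj (suc i) (suc x)       = suc (swapAdj i x)

applySwaps : ∀ {n} → List (Fin n) → Fin (suc n) → Fin (suc n)
applySwaps []      x = x
applySwaps (i ∷ w) x = swapAdj i (applySwaps w x)

applySwaps-++ : ∀ {n} (w w′ : List (Fin n)) x → applySwaps (w ++ w′) x ≡ applySwaps w (applySwaps w′ x)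
applySwaps-++ []      w′ x = refl
applySwaps-++ (i ∷ w) w′ x = cong (swapAdj i) (applySwaps-++ w w′ x)

applySwaps-lift-zero : ∀ {n} (w : List (Fin n)) → applySwaps (List.map suc w) zero ≡ zero
applySwaps-lift-zero []      = refl
applySwaps-lift-zero (i ∷ w) = cong (swapAdj (suc i)) (applySwaps-lift-zero w)

applySwaps-lift-suc : ∀ {n} (w : List (Fin n)) x → applySwaps (List.map suc w) (suc x) ≡ suc (applySwaps w x)
applySwaps-lift-suc []      x = refl
applySwaps-lift-suc (i ∷ w) x = cong (swapAdj (suc i)) (applySwaps-lift-suc w x)

-- moves 0 to p and shifts 1, …, p down by one place
rotateTo : ∀ {n} → Fin (suc n) → List (Fin n)
rotateTo zero            = []
rotateTo {suc n} (suc p) = List.map suc (rotateTo p) ++ (zero ∷ [])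

rotateTo-zero : ∀ {n} (p : Fin (suc n)) → applySwaps (rotateTo p) zero ≡ p
rotateTo-zero zero            = refl
rotateTo-zero {suc n} (suc p) =
  trans (applySwaps-++ (List.map suc (rotateTo p)) _ zero)
        (trans (applySwaps-lift-suc (rotateTo p) zero) (cong suc (rotateTo-zero p)))

rotateTo-suc : ∀ {n} (p : Fin (suc n)) x → applySwaps (rotateTo p) (suc x) ≡ punchIn p x
rotateTo-suc zero            x       = refl
rotateTo-suc {suc n} (suc p) zero    =
  trans (applySwaps-++ (List.map suc (rotateTo p)) _ (suc zero)) (applySwaps-lift-zero (rotateTo p))
rotateTo-suc {suc n} (suc p) (suc x) =
  trans (applySwaps-++ (List.map suc (rotateTo p)) _ (suc (suc x)))
        (trans (applySwaps-lift-suc (rotateTo p) (suc x)) (cong suc (rotateTo-suc p x)))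

-- An injection σ is rotateTo (σ 0) composed with the lift of the injection punchOut ∘ σ ∘ suc.
injective⇒swaps : ∀ {n} (σ : Fin (suc n) → Fin (suc n)) → Injective _≡_ _≡_ σ →
  Σ (List (Fin n)) λ w → ∀ x → σ x ≡ applySwaps w x
injective⇒swaps {zero}  σ σ-inj = [] , λ { zero → Fin1-unique (σ zero) }
  where
  Fin1-unique : (y : Fin 1) → y ≡ zero
  Fin1-unique zero = refl
injective⇒swaps {suc n} σ σ-inj = rotateTo p ++ List.map suc w , σ≗
  where
  p = σ zero
  p≢ : ∀ x → p ≢ σ (suc x)
  p≢ x eq with σ-inj eq
  ... | ()
  τ : Fin (suc n) → Fin (suc n)
  τ x = punchOut (p≢ x)
  τ-inj : Injective _≡_ _≡_ τ
  τ-inj {x} {y} eq = suc-injective (σ-inj (punchOut-injective (p≢ x) (p≢ y) eq))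
  w = proj₁ (injective⇒swaps τ τ-inj)
  τ≗ = proj₂ (injective⇒swaps τ τ-inj)
  σ≗ : ∀ x → σ x ≡ applySwaps (rotateTo p ++ List.map suc w) x
  σ≗ zero = sym (begin
    applySwaps (rotateTo p ++ List.map suc w) zero
      ≡⟨ applySwaps-++ (rotateTo p) _ zero ⟩
    applySwaps (rotateTo p) (applySwaps (List.map suc w) zero)
      ≡⟨ cong (applySwaps (rotateTo p)) (applySwaps-lift-zero w) ⟩
    applySwaps (rotateTo p) zero
      ≡⟨ rotateTo-zero p ⟩
    p ∎)
    where open ≡-Reasoning
  σ≗ (suc x) = sym (begin
    applySwaps (rotateTo p ++ List.map suc w) (suc x)
      ≡⟨ applySwaps-++ (rotateTo p) _ (suc x) ⟩
    applySwaps (rotateTo p) (applySwaps (List.map suc w) (suc x))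
      ≡⟨ cong (applySwaps (rotateTo p)) (applySwaps-lift-suc w x) ⟩
    applySwaps (rotateTo p) (suc (applySwaps w x))
      ≡⟨ rotateTo-suc p (applySwaps w x) ⟩
    punchIn p (applySwaps w x)
      ≡⟨ cong (punchIn p) (sym (τ≗ x)) ⟩
    punchIn p (punchOut (p≢ x))
      ≡⟨ punchIn-punchOut (p≢ x) ⟩
    σ (suc x) ∎)
    where open ≡-Reasoning

sumFin-swapAdj : ∀ {n} i (f : Fin (suc n) → ℤ) → sumFin (f ∘ swapAdj i) ≡ sumFin f
sumFin-swapAdj {suc n} zero    f = left-comm (f (suc zero)) (f zero) _
  where
  left-comm : ∀ a b c → a + (b + c) ≡ b + (a + c)
  left-comm = solve-∀
sumFin-swapAdj {suc n} (suc i) f = cong (_+_ (f zero)) (sumFin-swapAdj i (f ∘ suc))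

sumFin-applySwaps : ∀ {n} (w : List (Fin n)) (f : Fin (suc n) → ℤ) → sumFin (f ∘ applySwaps w) ≡ sumFin f
sumFin-applySwaps []      f = refl
sumFin-applySwaps (i ∷ w) f = trans (sumFin-applySwaps w (f ∘ swapAdj i)) (sumFin-swapAdj i f)

sumFin-injective : ∀ {n} (σ : Fin n → Fin n) → Injective _≡_ _≡_ σ → (f : Fin n → ℤ) →
  sumFin (f ∘ σ) ≡ sumFin f
sumFin-injective {zero}  σ σ-inj f = refl
sumFin-injective {suc n} σ σ-inj f with injective⇒swaps σ σ-inj
... | w , σ≗ = trans (sumFin-cong (cong f ∘ σ≗)) (sumFin-applySwaps w f)

-- Determinants

Square : ℕ → Set
Square n = Fin n → Fin n → ℤ

sgn : ∀ {n} → Fin n → ℤ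
sgn j = sign (toℕ j)

sign-suc : ∀ n → sign (suc n) ≡ - sign n
sign-suc zero          = refl
sign-suc (suc zero)    = refl
sign-suc (suc (suc n)) = sign-suc n

minor : ∀ {n} → Square (suc n) → Fin (suc n) → Square n
minor M j r c = M (suc r) (punchIn j c)

laplaceTerm : ∀ {n} → Square (suc n) → Fin (suc n) → ℤ
laplaceTerm M j = sgn j * (M zero j * det (minor M j))

det-cong : ∀ {n} {M N : Square n} → (∀ r c → M r c ≡ N r c) → det M ≡ det N
det-cong {zero}  M≗N = refl
det-cong {suc n} M≗N = sumFin-cong λ j →
  cong₂ (λ x y → sgn j * (x * y)) (M≗N zero j) (det-cong (λ r c → M≗N (suc r) (punchIn j c)))

*-neg-inner : ∀ a b c → a * (b * - c) ≡ - (a * (b * c))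
*-neg-inner = solve-∀

data SwapPunchIn {m} (i : Fin (suc m)) (j : Fin (suc (suc m))) : Set where
  moved : (∀ c → swapAdj i (punchIn j c) ≡ punchIn (swapAdj i j) c) → sgn (swapAdj i j) ≡ - sgn j →
          SwapPunchIn i j
  fixed : (i′ : Fin m) → (∀ c → swapAdj i (punchIn j c) ≡ punchIn j (swapAdj i′ c)) → swapAdj i j ≡ j →
          SwapPunchIn i j

swapPunchIn : ∀ {m} i j → SwapPunchIn {m} i j
swapPunchIn zero          zero          = moved (λ { zero → refl ; (suc c) → refl }) refl
swapPunchIn zero          (suc zero)    = moved (λ { zero → refl ; (suc c) → refl }) refl
swapPunchIn {suc m} zero  (suc (suc j)) =
  fixed zero (λ { zero → refl ; (suc zero) → refl ; (suc (suc c)) → refl }) refl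
swapPunchIn (suc i)       zero          = fixed i (λ c → refl) refl
swapPunchIn {suc m} (suc i) (suc j) with swapPunchIn i j
... | moved punch≗ sgn≡ = moved (λ { zero → refl ; (suc c) → cong suc (punch≗ c) })
  (trans (sign-suc (toℕ (swapAdj i j))) (trans (cong -_ sgn≡) (cong -_ (sym (sign-suc (toℕ j))))))
... | fixed i′ punch≗ j-fixed =
  fixed (suc i′) (λ { zero → refl ; (suc c) → cong suc (punch≗ c) }) (cong suc j-fixed)

-- The statement for the minors is a hypothesis so that det-swapColumns recurses structurally on m.
det-swapColumns-via-minors : ∀ {m} (i : Fin (suc m)) (M : Square (suc (suc m))) →
  (∀ (i′ : Fin m) (N : Square (suc m)) → det (λ r c → N r (swapAdj i′ c)) ≡ - det N) →
  det (λ r c → M r (swapAdj i c)) ≡ - det M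
det-swapColumns-via-minors i M det-swap-minor = begin
  det (λ r c → M r (swapAdj i c))                    ≡⟨ sumFin-cong term ⟩
  sumFin (λ j → - laplaceTerm M (swapAdj i j))       ≡⟨ sumFin-swapAdj i (λ j → - laplaceTerm M j) ⟩
  sumFin (λ j → - laplaceTerm M j)                   ≡⟨ sym (neg-distrib-sumFin (laplaceTerm M)) ⟩
  - det M                                            ∎
  where
  open ≡-Reasoning
  term : ∀ j → laplaceTerm (λ r c → M r (swapAdj i c)) j ≡ - laplaceTerm M (swapAdj i j)
  term j with swapPunchIn i j
  ... | moved punch≗ sgn≡ = begin
    sgn j * (M zero (swapAdj i j) * det (λ r c → M (suc r) (swapAdj i (punchIn j c))))
      ≡⟨ cong (λ D → sgn j * (M zero (swapAdj i j) * D)) (det-cong (λ r c → cong (M (suc r)) (punch≗ c))) ⟩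
    sgn j * (M zero (swapAdj i j) * det (minor M (swapAdj i j)))
      ≡⟨ cong (λ s → s * (M zero (swapAdj i j) * det (minor M (swapAdj i j))))
              (trans (sym (ℤP.neg-involutive (sgn j))) (cong -_ (sym sgn≡))) ⟩
    - sgn (swapAdj i j) * (M zero (swapAdj i j) * det (minor M (swapAdj i j)))
      ≡⟨ sym (ℤP.neg-distribˡ-* (sgn (swapAdj i j)) _) ⟩
    - laplaceTerm M (swapAdj i j)                                                     ∎
  ... | fixed i′ punch≗ j-fixed rewrite j-fixed = begin
    sgn j * (M zero j * det (λ r c → M (suc r) (swapAdj i (punchIn j c))))
      ≡⟨ cong (λ D → sgn j * (M zero j * D)) (det-cong (λ r c → cong (M (suc r)) (punch≗ c))) ⟩
    sgn j * (M zero j * det (λ r c → minor M j r (swapAdj i′ c)))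
      ≡⟨ cong (λ D → sgn j * (M zero j * D)) (det-swap-minor i′ (minor M j)) ⟩
    sgn j * (M zero j * - det (minor M j))
      ≡⟨ *-neg-inner (sgn j) (M zero j) (det (minor M j)) ⟩
    - laplaceTerm M j                                                                 ∎

det-swapColumns : ∀ {m} (i : Fin (suc m)) (M : Square (suc (suc m))) →
  det (λ r c → M r (swapAdj i c)) ≡ - det M
det-swapColumns {zero}  i M = det-swapColumns-via-minors i M λ ()
det-swapColumns {suc m} i M = det-swapColumns-via-minors i M det-swapColumns

-- A pair (j, k) with k : Fin n stands for the pair of distinct columns (j, punchIn j k).
onDistinct : ∀ {n} → (Fin (suc n) → Fin n → ℤ) → Fin (suc n) → Fin (suc n) → ℤ
onDistinct F a b with a Fin.≟ b
... | yes _   = + 0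
... | no a≢b = F a (punchOut a≢b)

onDistinct-diagonal : ∀ {n} (F : Fin (suc n) → Fin n → ℤ) a → onDistinct F a a ≡ + 0
onDistinct-diagonal F a with a Fin.≟ a
... | yes _   = refl
... | no a≢a = ⊥-elim (a≢a refl)

onDistinct-punchIn : ∀ {n} (F : Fin (suc n) → Fin n → ℤ) a k → onDistinct F a (punchIn a k) ≡ F a k
onDistinct-punchIn F a k with a Fin.≟ punchIn a k
... | yes a≡ = ⊥-elim (punchInᵢ≢i a k (sym a≡))
... | no a≢  = cong (F a) (trans (punchOut-cong a refl) (punchOut-punchIn a))

sumFin-onDistinct : ∀ {n} (F : Fin (suc n) → Fin n → ℤ) →
  sumFin (λ j → sumFin (F j)) ≡ sumFin (λ a → sumFin (onDistinct F a))
sumFin-onDistinct F = sumFin-cong λ a → sym (begin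
  sumFin (onDistinct F a)                                        ≡⟨ sumFin-punchIn (onDistinct F a) a ⟩
  onDistinct F a a + sumFin (onDistinct F a ∘ punchIn a)         ≡⟨ cong₂ _+_ (onDistinct-diagonal F a)
                                                                      (sumFin-cong (onDistinct-punchIn F a)) ⟩
  + 0 + sumFin (F a)                                             ≡⟨ ℤP.+-identityˡ _ ⟩
  sumFin (F a)                                                   ∎)
  where open ≡-Reasoning

punchIn-punchOut-comm : ∀ {n} {a b : Fin (suc (suc n))} (a≢b : a ≢ b) (b≢a : b ≢ a) c →
  punchIn a (punchIn (punchOut a≢b) c) ≡ punchIn b (punchIn (punchOut b≢a) c)
punchIn-punchOut-comm {a = zero}  {zero}  a≢b b≢a c = ⊥-elim (a≢b refl)
punchIn-punchOut-comm {a = zero}  {suc b} a≢b b≢a c = refl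
punchIn-punchOut-comm {a = suc a} {zero}  a≢b b≢a c = refl
punchIn-punchOut-comm {zero}  {suc zero} {suc zero} a≢b b≢a c = ⊥-elim (a≢b refl)
punchIn-punchOut-comm {suc n} {suc a} {suc b} a≢b b≢a zero    = refl
punchIn-punchOut-comm {suc n} {suc a} {suc b} a≢b b≢a (suc c) =
  cong suc (punchIn-punchOut-comm (a≢b ∘ cong suc) (b≢a ∘ cong suc) c)

sgn-punchOut-antisym : ∀ {n} {a b : Fin (suc (suc n))} (a≢b : a ≢ b) (b≢a : b ≢ a) →
  sgn a * sgn (punchOut a≢b) ≡ - (sgn b * sgn (punchOut b≢a))
sgn-punchOut-antisym {a = zero}  {zero}  a≢b b≢a = ⊥-elim (a≢b refl)
sgn-punchOut-antisym {a = zero}  {suc b} a≢b b≢a =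
  trans (flip (sgn b)) (cong (λ s → - (s * + 1)) (sym (sign-suc (toℕ b))))
  where
  flip : ∀ x → + 1 * x ≡ - (- x * + 1)
  flip = solve-∀
sgn-punchOut-antisym {a = suc a} {zero}  a≢b b≢a =
  trans (cong (_* + 1) (sign-suc (toℕ a))) (flip (sgn a))
  where
  flip : ∀ x → - x * + 1 ≡ - (+ 1 * x)
  flip = solve-∀
sgn-punchOut-antisym {zero}  {suc zero} {suc zero} a≢b b≢a = ⊥-elim (a≢b refl)
sgn-punchOut-antisym {suc n} {suc a} {suc b} a≢b b≢a = begin
  sgn (suc a) * sgn (suc p)          ≡⟨ cong₂ _*_ (sign-suc (toℕ a)) (sign-suc (toℕ p)) ⟩
  - sgn a * - sgn p                  ≡⟨ neg-*-neg (sgn a) (sgn p) ⟩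
  sgn a * sgn p                      ≡⟨ sgn-punchOut-antisym (a≢b ∘ cong suc) (b≢a ∘ cong suc) ⟩
  - (sgn b * sgn q)                  ≡⟨ cong -_ (sym (neg-*-neg (sgn b) (sgn q))) ⟩
  - (- sgn b * - sgn q)              ≡⟨ cong -_ (sym (cong₂ _*_ (sign-suc (toℕ b)) (sign-suc (toℕ q)))) ⟩
  - (sgn (suc b) * sgn (suc q))      ∎
  where
  open ≡-Reasoning
  p = punchOut (a≢b ∘ cong suc)
  q = punchOut (b≢a ∘ cong suc)
  neg-*-neg : ∀ x y → - x * - y ≡ x * y
  neg-*-neg = solve-∀

-- the term of the columns (j, punchIn j k) in the expansion of det M along rows 0 and 1
pairTerm : ∀ {n} → Square (suc (suc n)) → Fin (suc (suc n)) → Fin (suc n) → ℤ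
pairTerm M j k = sgn j * (M zero j * laplaceTerm (minor M j) k)

det-expand₂ : ∀ {n} (M : Square (suc (suc n))) → det M ≡ sumFin (λ j → sumFin (pairTerm M j))
det-expand₂ M = sumFin-cong λ j →
  trans (cong (sgn j *_) (*-distribˡ-sumFin (M zero j) (laplaceTerm (minor M j))))
        (*-distribˡ-sumFin (sgn j) (λ k → M zero j * laplaceTerm (minor M j) k))

swapRows01 : ∀ {n} → Square (suc (suc n)) → Square (suc (suc n))
swapRows01 M r c = M (swapAdj zero r) c

onDistinct-pairTerm-swapRows01 : ∀ {n} (M : Square (suc (suc n))) a b →
  onDistinct (pairTerm (swapRows01 M)) a b ≡ - onDistinct (pairTerm M) b a
onDistinct-pairTerm-swapRows01 M a b with a Fin.≟ b | b Fin.≟ a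
... | yes _   | yes _   = refl
... | yes a≡b | no b≢a = ⊥-elim (b≢a (sym a≡b))
... | no a≢b | yes b≡a = ⊥-elim (a≢b (sym b≡a))
... | no a≢b | no b≢a = begin
  sgn a * (M (suc zero) a * (sgn p * (M zero (punchIn a p) * det (rest a p))))
    ≡⟨ cong₂ (λ x D → sgn a * (M (suc zero) a * (sgn p * (M zero x * D))))
             (punchIn-punchOut a≢b)
             (det-cong (λ r c → cong (M (suc (suc r))) (punchIn-punchOut-comm a≢b b≢a c))) ⟩
  sgn a * (M (suc zero) a * (sgn p * (M zero b * det (rest b q))))
    ≡⟨ exchange (sgn a) (sgn p) (sgn b) (sgn q) (M (suc zero) a) (M zero b) (det (rest b q))
                (sgn-punchOut-antisym a≢b b≢a) ⟩
  - (sgn b * (M zero b * (sgn q * (M (suc zero) a * det (rest b q)))))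
    ≡⟨ cong (λ x → - (sgn b * (M zero b * (sgn q * (M (suc zero) x * det (rest b q))))))
            (sym (punchIn-punchOut b≢a)) ⟩
  - (sgn b * (M zero b * (sgn q * (M (suc zero) (punchIn b q) * det (rest b q))))) ∎
  where
  open ≡-Reasoning
  p = punchOut a≢b
  q = punchOut b≢a
  rest : ∀ j k → Square _
  rest j k r c = M (suc (suc r)) (punchIn j (punchIn k c))
  exchange : ∀ sa sp sb sq x y D → sa * sp ≡ - (sb * sq) →
    sa * (x * (sp * (y * D))) ≡ - (sb * (y * (sq * (x * D))))
  exchange sa sp sb sq x y D sasp≡ = begin
    sa * (x * (sp * (y * D)))       ≡⟨ regroup sa sp x y D ⟩
    sa * sp * (x * y * D)           ≡⟨ cong (_* (x * y * D)) sasp≡ ⟩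
    - (sb * sq) * (x * y * D)       ≡⟨ regroup′ sb sq x y D ⟩
    - (sb * (y * (sq * (x * D))))   ∎
    where
    regroup : ∀ sa sp x y D → sa * (x * (sp * (y * D))) ≡ sa * sp * (x * y * D)
    regroup = solve-∀
    regroup′ : ∀ sb sq x y D → - (sb * sq) * (x * y * D) ≡ - (sb * (y * (sq * (x * D))))
    regroup′ = solve-∀

det-swapRows01 : ∀ {n} (M : Square (suc (suc n))) → det (swapRows01 M) ≡ - det M
det-swapRows01 M = begin
  det (swapRows01 M)
    ≡⟨ det-expand₂ (swapRows01 M) ⟩
  sumFin (λ j → sumFin (pairTerm (swapRows01 M) j))
    ≡⟨ sumFin-onDistinct (pairTerm (swapRows01 M)) ⟩
  sumFin (λ a → sumFin (λ b → onDistinct (pairTerm (swapRows01 M)) a b))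
    ≡⟨ sumFin-cong (λ a → sumFin-cong (onDistinct-pairTerm-swapRows01 M a)) ⟩
  sumFin (λ a → sumFin (λ b → - onDistinct (pairTerm M) b a))
    ≡⟨ sumFin-cong (λ a → sym (neg-distrib-sumFin (λ b → onDistinct (pairTerm M) b a))) ⟩
  sumFin (λ a → - sumFin (λ b → onDistinct (pairTerm M) b a))
    ≡⟨ sym (neg-distrib-sumFin (λ a → sumFin (λ b → onDistinct (pairTerm M) b a))) ⟩
  - sumFin (λ a → sumFin (λ b → onDistinct (pairTerm M) b a))
    ≡⟨ cong -_ (sumFin-comm (λ a b → onDistinct (pairTerm M) b a)) ⟩
  - sumFin (λ b → sumFin (onDistinct (pairTerm M) b))
    ≡⟨ cong -_ (sym (trans (det-expand₂ M) (sumFin-onDistinct (pairTerm M)))) ⟩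
  - det M ∎
  where open ≡-Reasoning

det-swapRows : ∀ {m} (i : Fin (suc m)) (M : Square (suc (suc m))) → det (λ r c → M (swapAdj i r) c) ≡ - det M
det-swapRows zero M = det-swapRows01 M
det-swapRows {suc m} (suc i) M = begin
  sumFin (λ j → sgn j * (M zero j * det (λ r c → minor M j (swapAdj i r) c)))
    ≡⟨ sumFin-cong (λ j → cong (λ D → sgn j * (M zero j * D)) (det-swapRows i (minor M j))) ⟩
  sumFin (λ j → sgn j * (M zero j * - det (minor M j)))
    ≡⟨ sumFin-cong (λ j → *-neg-inner (sgn j) (M zero j) (det (minor M j))) ⟩
  sumFin (λ j → - laplaceTerm M j)
    ≡⟨ sym (neg-distrib-sumFin (laplaceTerm M)) ⟩
  - det M ∎
  where open ≡-Reasoning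

det-conj-swapAdj : ∀ {m} (i : Fin (suc m)) (M : Square (suc (suc m))) →
  det (λ r c → M (swapAdj i r) (swapAdj i c)) ≡ det M
det-conj-swapAdj i M =
  trans (det-swapRows i (λ r c → M r (swapAdj i c))) (trans (cong -_ (det-swapColumns i M)) (ℤP.neg-involutive _))

det-conj-applySwaps : ∀ {m} (w : List (Fin m)) (M : Square (suc m)) →
  det (λ r c → M (applySwaps w r) (applySwaps w c)) ≡ det M
det-conj-applySwaps []              M = refl
det-conj-applySwaps {suc m} (i ∷ w) M =
  trans (det-conj-applySwaps w (λ r c → M (swapAdj i r) (swapAdj i c))) (det-conj-swapAdj i M)

det-conj-injective : ∀ {n n′} → n ≡ n′ → (σ : Fin n → Fin n′) → Injective _≡_ _≡_ σ →
  (M : Square n′) → det (λ r c → M (σ r) (σ c)) ≡ det M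
det-conj-injective {zero}  refl σ σ-inj M = refl
det-conj-injective {suc n} refl σ σ-inj M with injective⇒swaps σ σ-inj
... | w , σ≗ = trans (det-cong (λ r c → cong₂ M (σ≗ r) (σ≗ c))) (det-conj-applySwaps w M)

self-neg⇒zero : ∀ x → x ≡ - x → x ≡ + 0
self-neg⇒zero (+ zero)     _  = refl
self-neg⇒zero (+ suc n)    ()
self-neg⇒zero (ℤ.-[1+ n ]) ()

det-equalRows01 : ∀ {n} (M : Square (suc (suc n))) → (∀ c → M zero c ≡ M (suc zero) c) → det M ≡ + 0
det-equalRows01 M row₀≡row₁ = self-neg⇒zero (det M) (trans (sym (det-cong swapRows01≗)) (det-swapRows01 M))
  where
  swapRows01≗ : ∀ r c → swapRows01 M r c ≡ M r c
  swapRows01≗ zero          c = sym (row₀≡row₁ c)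
  swapRows01≗ (suc zero)    c = row₀≡row₁ c
  swapRows01≗ (suc (suc r)) c = refl

subtractRow1 : ∀ {n} → Square (suc (suc n)) → Square (suc (suc n))
subtractRow1 M zero    c = M zero c - M (suc zero) c
subtractRow1 M (suc r) c = M (suc r) c

det-subtractRow1 : ∀ {n} (M : Square (suc (suc n))) → det (subtractRow1 M) ≡ det M
det-subtractRow1 M = begin
  det (subtractRow1 M)
    ≡⟨ sumFin-cong split ⟩
  sumFin (λ j → laplaceTerm M j + - laplaceTerm M₁₁ j)
    ≡⟨ sumFin-distrib-+ (laplaceTerm M) (λ j → - laplaceTerm M₁₁ j) ⟩
  det M + sumFin (λ j → - laplaceTerm M₁₁ j)
    ≡⟨ cong (_+_ (det M)) (sym (neg-distrib-sumFin (laplaceTerm M₁₁))) ⟩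
  det M + - det M₁₁
    ≡⟨ cong (λ D → det M + - D) (det-equalRows01 M₁₁ λ c → refl) ⟩
  det M + - + 0
    ≡⟨ ℤP.+-identityʳ (det M) ⟩
  det M ∎
  where
  open ≡-Reasoning
  M₁₁ : Square _
  M₁₁ zero    c = M (suc zero) c
  M₁₁ (suc r) c = M (suc r) c
  distrib : ∀ s a b D → s * ((a - b) * D) ≡ s * (a * D) + - (s * (b * D))
  distrib = solve-∀
  split : ∀ j → laplaceTerm (subtractRow1 M) j ≡ laplaceTerm M j + - laplaceTerm M₁₁ j
  split j = distrib (sgn j) (M zero j) (M (suc zero) j) (det (minor M j))

det-row0-e₀-e₁ : ∀ {n} (M : Square (suc (suc n))) x →
  M zero zero ≡ x → M zero (suc zero) ≡ - x → (∀ c → M zero (suc (suc c)) ≡ + 0) →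
  det M ≡ x * (det (minor M zero) + det (minor M (suc zero)))
det-row0-e₀-e₁ M x M₀₀ M₀₁ M₀ₖ = begin
  det M
    ≡⟨ cong₂ _+_ (cong (λ y → + 1 * (y * D₀)) M₀₀)
                 (cong₂ _+_ (cong (λ y → - + 1 * (y * D₁)) M₀₁)
                            (sumFin-zero (λ c → laplaceTerm M (suc (suc c))) rest≡0)) ⟩
  + 1 * (x * D₀) + (- + 1 * (- x * D₁) + + 0)
    ≡⟨ collect x D₀ D₁ ⟩
  x * (D₀ + D₁) ∎
  where
  open ≡-Reasoning
  D₀ = det (minor M zero)
  D₁ = det (minor M (suc zero))
  rest≡0 : ∀ c → laplaceTerm M (suc (suc c)) ≡ + 0
  rest≡0 c = begin
    sgn (suc (suc c)) * (M zero (suc (suc c)) * det (minor M (suc (suc c))))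
      ≡⟨ cong (λ y → sgn (suc (suc c)) * (y * det (minor M (suc (suc c))))) (M₀ₖ c) ⟩
    sgn (suc (suc c)) * (+ 0 * det (minor M (suc (suc c))))
      ≡⟨ cong (sgn (suc (suc c)) *_) (ℤP.*-zeroˡ (det (minor M (suc (suc c))))) ⟩
    sgn (suc (suc c)) * + 0
      ≡⟨ ℤP.*-zeroʳ (sgn (suc (suc c))) ⟩
    + 0 ∎
  collect : ∀ x a b → + 1 * (x * a) + (- + 1 * (- x * b) + + 0) ≡ x * (a + b)
  collect = solve-∀

Column0Sum : ∀ {n} → Square (suc n) → Square (suc n) → Square (suc n) → Set
Column0Sum A B C =
  (∀ r c → A r (suc c) ≡ C r (suc c)) × (∀ r c → B r (suc c) ≡ C r (suc c)) ×
  (∀ r → C r zero ≡ A r zero + B r zero)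

det-additive-column0 : ∀ {n} (A B C : Square (suc n)) → Column0Sum A B C → det C ≡ det A + det B

laplaceTerm-additive-column0 : ∀ {n} (A B C : Square (suc n)) → Column0Sum A B C →
  ∀ j → laplaceTerm C j ≡ laplaceTerm A j + laplaceTerm B j
laplaceTerm-additive-column0 A B C (A≗C , B≗C , C₀) zero = begin
  + 1 * (C zero zero * det (minor C zero))
    ≡⟨ cong (λ x → + 1 * (x * det (minor C zero))) (C₀ zero) ⟩
  + 1 * ((A zero zero + B zero zero) * det (minor C zero))
    ≡⟨ distrib (+ 1) (A zero zero) (B zero zero) (det (minor C zero)) ⟩
  + 1 * (A zero zero * det (minor C zero)) + + 1 * (B zero zero * det (minor C zero))
    ≡⟨ cong₂ (λ D D′ → + 1 * (A zero zero * D) + + 1 * (B zero zero * D′))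
             (det-cong (λ r c → sym (A≗C (suc r) c))) (det-cong (λ r c → sym (B≗C (suc r) c))) ⟩
  laplaceTerm A zero + laplaceTerm B zero ∎
  where
  open ≡-Reasoning
  distrib : ∀ s x y D → s * ((x + y) * D) ≡ s * (x * D) + s * (y * D)
  distrib = solve-∀
laplaceTerm-additive-column0 {suc n} A B C (A≗C , B≗C , C₀) (suc j) = begin
  s * (C zero (suc j) * det (minor C (suc j)))
    ≡⟨ cong (λ D → s * (C zero (suc j) * D))
            (det-additive-column0 (minor A (suc j)) (minor B (suc j)) (minor C (suc j))
               ((λ r c → A≗C (suc r) (punchIn j c)) , (λ r c → B≗C (suc r) (punchIn j c)) ,
                (λ r → C₀ (suc r)))) ⟩
  s * (C zero (suc j) * (det (minor A (suc j)) + det (minor B (suc j))))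
    ≡⟨ distrib s (C zero (suc j)) _ _ ⟩
  s * (C zero (suc j) * det (minor A (suc j))) + s * (C zero (suc j) * det (minor B (suc j)))
    ≡⟨ cong₂ (λ x y → s * (x * det (minor A (suc j))) + s * (y * det (minor B (suc j))))
             (sym (A≗C zero j)) (sym (B≗C zero j)) ⟩
  laplaceTerm A (suc j) + laplaceTerm B (suc j) ∎
  where
  open ≡-Reasoning
  s = sgn (suc j)
  distrib : ∀ s x D D′ → s * (x * (D + D′)) ≡ s * (x * D) + s * (x * D′)
  distrib = solve-∀

det-additive-column0 A B C split =
  trans (sumFin-cong (laplaceTerm-additive-column0 A B C split)) (sumFin-distrib-+ (laplaceTerm A) (laplaceTerm B))

-- Matrices that are constant on the blocks of a partition

δ : ∀ {n} → Fin n → Fin n → ℤ → ℤ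
δ u v x = if ⌊ u Fin.≟ v ⌋ then x else + 0

δ-≡ : ∀ {n} {u v : Fin n} x → u ≡ v → δ u v x ≡ x
δ-≡ {u = u} {v} x u≡v with u Fin.≟ v
... | yes _   = refl
... | no u≢v = ⊥-elim (u≢v u≡v)

δ-≢ : ∀ {n} {u v : Fin n} x → u ≢ v → δ u v x ≡ + 0
δ-≢ {u = u} {v} x u≢v with u Fin.≟ v
... | yes u≡v = ⊥-elim (u≢v u≡v)
... | no _    = refl

δ-reflects : ∀ {n n′} {u v : Fin n} {u′ v′ : Fin n′} x →
  (u ≡ v → u′ ≡ v′) → (u′ ≡ v′ → u ≡ v) → δ u v x ≡ δ u′ v′ x
δ-reflects {u = u} {v} x ⇒ ⇐ with u Fin.≟ v
... | yes u≡v = sym (δ-≡ x (⇒ u≡v))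
... | no u≢v = sym (δ-≢ x (u≢v ∘ ⇐))

δ-suc : ∀ {n} (u v : Fin n) x → δ (suc u) (suc v) x ≡ δ u v x
δ-suc u v x = δ-reflects x suc-injective (cong suc)

δ-distrib-+ : ∀ {n} (u v : Fin n) x y → δ u v (x + y) ≡ δ u v x + δ u v y
δ-distrib-+ u v x y with ⌊ u Fin.≟ v ⌋
... | true  = refl
... | false = refl

indicator : ∀ {n} → Fin n → Fin n → ℕ
indicator u v = if ⌊ u Fin.≟ v ⌋ then 1 else 0

+-indicator : ∀ {n} (u v : Fin n) → + indicator u v ≡ δ u v (+ 1)
+-indicator u v with ⌊ u Fin.≟ v ⌋
... | true  = refl
... | false = refl

indicator-≡ : ∀ {n} {u v : Fin n} → u ≡ v → indicator u v ≡ 1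
indicator-≡ {u = u} {v} u≡v with u Fin.≟ v
... | yes _   = refl
... | no u≢v = ⊥-elim (u≢v u≡v)

indicator-≢ : ∀ {n} {u v : Fin n} → u ≢ v → indicator u v ≡ 0
indicator-≢ {u = u} {v} u≢v with u Fin.≟ v
... | yes u≡v = ⊥-elim (u≢v u≡v)
... | no _    = refl

sumℕ-injective : ∀ {n} (σ : Fin n → Fin n) → Injective _≡_ _≡_ σ → (f : Fin n → ℕ) →
  sumℕ (f ∘ σ) ≡ sumℕ f
sumℕ-injective σ σ-inj f =
  ℤP.+-injective (trans (+-sumℕ (f ∘ σ)) (trans (sumFin-injective σ σ-inj (+_ ∘ f)) (sym (+-sumℕ f))))

sumℕ-single : ∀ {n} (f : Fin n → ℕ) i → (∀ j → j ≢ i → f j ≡ 0) → sumℕ f ≡ f i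
sumℕ-single f i f≗0 =
  ℤP.+-injective (trans (+-sumℕ f) (sumFin-single (+_ ∘ f) i (λ j j≢i → cong +_ (f≗0 j j≢i))))

classWeight : ∀ {n m} → (Fin n → Fin m) → (Fin n → ℤ) → Fin m → ℤ
classWeight cls w d = sumFin (λ v → δ (cls v) d (w v))

classSize : ∀ {n m} → (Fin n → Fin m) → Fin m → ℕ
classSize cls d = sumℕ (λ v → indicator (cls v) d)

classWeight-one : ∀ {n m} (cls : Fin n → Fin m) d → classWeight cls (λ _ → + 1) d ≡ + classSize cls d
classWeight-one cls d =
  trans (sumFin-cong (λ v → sym (+-indicator (cls v) d))) (sym (+-sumℕ (λ v → indicator (cls v) d)))

Onto : ∀ {n m} → (Fin n → Fin m) → Set
Onto {n} cls = ∀ d → Σ (Fin n) λ v → cls v ≡ d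

module ClassMatrix {m : ℕ} (s : Fin m → ℤ) (B : Fin m → Fin m → ℤ) where

  classMatrix : ∀ {n} → (Fin n → Fin m) → (Fin n → ℤ) → Square n
  classMatrix cls w u v = δ u v (s (cls u)) - B (cls u) (cls v) * w v

  quotientMatrix : ∀ {n} → (Fin n → Fin m) → (Fin n → ℤ) → Square m
  quotientMatrix cls w d e = δ d e (s d) - B d e * classWeight cls w e

  classFactor : ∀ {n} → (Fin n → Fin m) → ℤ
  classFactor cls = prodFin (λ d → s d ^ (classSize cls d ∸ 1))

  FactorsThroughQuotient : ∀ {n} → (Fin n → Fin m) → (Fin n → ℤ) → Set
  FactorsThroughQuotient cls w = det (classMatrix cls w) ≡ classFactor cls * det (quotientMatrix cls w)

  module _ {n} (σ : Fin n → Fin n) (σ-inj : Injective _≡_ _≡_ σ) (cls : Fin n → Fin m) (w : Fin n → ℤ)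
    where

    det-classMatrix-reindex : det (classMatrix (cls ∘ σ) (w ∘ σ)) ≡ det (classMatrix cls w)
    det-classMatrix-reindex =
      trans (det-cong (λ r c → cong (_- B (cls (σ r)) (cls (σ c)) * w (σ c))
                                    (δ-reflects (s (cls (σ r))) (cong σ) σ-inj)))
            (det-conj-injective refl σ σ-inj (classMatrix cls w))

    quotientMatrix-reindex : ∀ d e → quotientMatrix (cls ∘ σ) (w ∘ σ) d e ≡ quotientMatrix cls w d e
    quotientMatrix-reindex d e =
      cong (λ x → δ d e (s d) - B d e * x) (sumFin-injective σ σ-inj (λ v → δ (cls v) e (w v)))

    classFactor-reindex : classFactor (cls ∘ σ) ≡ classFactor cls
    classFactor-reindex =
      prodFin-cong (λ d → cong (λ k → s d ^ (k ∸ 1)) (sumℕ-injective σ σ-inj (λ v → indicator (cls v) d)))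

    factorsThroughQuotient-reindex : FactorsThroughQuotient (cls ∘ σ) (w ∘ σ) → FactorsThroughQuotient cls w
    factorsThroughQuotient-reindex factors = begin
      det (classMatrix cls w)                                      ≡⟨ sym det-classMatrix-reindex ⟩
      det (classMatrix (cls ∘ σ) (w ∘ σ))                          ≡⟨ factors ⟩
      classFactor (cls ∘ σ) * det (quotientMatrix (cls ∘ σ) (w ∘ σ))
        ≡⟨ cong₂ _*_ classFactor-reindex (det-cong quotientMatrix-reindex) ⟩
      classFactor cls * det (quotientMatrix cls w)                 ∎
      where open ≡-Reasoning

  mergeFront : ∀ {n} → (Fin (suc (suc n)) → ℤ) → Fin (suc n) → ℤ
  mergeFront w zero    = w zero + w (suc zero)
  mergeFront w (suc r) = w (suc (suc r))

  module _ {n} (cls : Fin (suc (suc n)) → Fin m) (w : Fin (suc (suc n)) → ℤ) (same : cls zero ≡ cls (suc zero))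
    where

    private
      γ = cls zero
      X = classMatrix cls w

    row₀-subtractRow1 : ∀ c → subtractRow1 X zero c ≡ δ zero c (s γ) - δ (suc zero) c (s γ)
    row₀-subtractRow1 c =
      trans (cong (λ g → X zero c - (δ (suc zero) c (s g) - B g (cls c) * w c)) (sym same))
            (cancel (δ zero c (s γ)) (δ (suc zero) c (s γ)) (B γ (cls c) * w c))
      where
      cancel : ∀ a b x → (a - x) - (b - x) ≡ a - b
      cancel = solve-∀

    column0Sum-merge : Column0Sum (minor (subtractRow1 X) zero) (minor (subtractRow1 X) (suc zero))
                                  (classMatrix (cls ∘ suc) (mergeFront w))
    column0Sum-merge = shifted , shifted , sum₀
      where
      shifted : ∀ r c → X (suc r) (suc (suc c)) ≡ classMatrix (cls ∘ suc) (mergeFront w) r (suc c)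
      shifted r c =
        cong (_- B (cls (suc r)) (cls (suc (suc c))) * w (suc (suc c))) (δ-suc r (suc c) (s (cls (suc r))))
      split : ∀ d b x y → d - b * (x + y) ≡ (d - b * y) + (+ 0 - b * x)
      split = solve-∀
      sum₀ : ∀ r → classMatrix (cls ∘ suc) (mergeFront w) r zero ≡ X (suc r) (suc zero) + X (suc r) zero
      sum₀ r = trans (split (δ r zero (s (cls (suc r)))) (B (cls (suc r)) (cls (suc zero))) (w zero) (w (suc zero)))
        (cong₂ _+_ (cong (_- B (cls (suc r)) (cls (suc zero)) * w (suc zero))
                         (sym (δ-suc r zero (s (cls (suc r))))))
                   (cong (λ g → + 0 - B (cls (suc r)) g * w zero) (sym same)))

    -- Row 0 minus row 1 is s γ (e₀ − e₁) because both rows belong to the class γ.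
    det-classMatrix-merge : det X ≡ s γ * det (classMatrix (cls ∘ suc) (mergeFront w))
    det-classMatrix-merge = begin
      det X
        ≡⟨ sym (det-subtractRow1 X) ⟩
      det R
        ≡⟨ det-row0-e₀-e₁ R (s γ) (trans (row₀-subtractRow1 zero) (ℤP.+-identityʳ (s γ)))
                                  (trans (row₀-subtractRow1 (suc zero)) (ℤP.+-identityˡ (- s γ)))
                                  (λ c → row₀-subtractRow1 (suc (suc c))) ⟩
      s γ * (det (minor R zero) + det (minor R (suc zero)))
        ≡⟨ cong (s γ *_) (sym (det-additive-column0 (minor R zero) (minor R (suc zero)) X′ column0Sum-merge)) ⟩
      s γ * det X′ ∎
      where
      open ≡-Reasoning
      R = subtractRow1 X
      X′ = classMatrix (cls ∘ suc) (mergeFront w)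

    quotientMatrix-merge : ∀ d e → quotientMatrix (cls ∘ suc) (mergeFront w) d e ≡ quotientMatrix cls w d e
    quotientMatrix-merge d e = cong (λ x → δ d e (s d) - B d e * x) (begin
      δ (cls (suc zero)) e (w zero + w (suc zero)) + rest
        ≡⟨ cong (_+ rest) (δ-distrib-+ (cls (suc zero)) e (w zero) (w (suc zero))) ⟩
      δ (cls (suc zero)) e (w zero) + δ (cls (suc zero)) e (w (suc zero)) + rest
        ≡⟨ cong (λ g → δ g e (w zero) + δ (cls (suc zero)) e (w (suc zero)) + rest) (sym same) ⟩
      δ γ e (w zero) + δ (cls (suc zero)) e (w (suc zero)) + rest
        ≡⟨ ℤP.+-assoc (δ γ e (w zero)) _ rest ⟩
      classWeight cls w e                                     ∎)
      where
      open ≡-Reasoning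
      rest = sumFin (λ r → δ (cls (suc (suc r))) e (w (suc (suc r))))

    classFactor-merge : classFactor cls ≡ s γ * classFactor (cls ∘ suc)
    classFactor-merge = prodFin-scaleAt _ _ γ (s γ) unchanged at-γ
      where
      unchanged : ∀ d → d ≢ γ → s d ^ (classSize cls d ∸ 1) ≡ s d ^ (classSize (cls ∘ suc) d ∸ 1)
      unchanged d d≢γ with γ Fin.≟ d
      ... | yes γ≡d = ⊥-elim (d≢γ (sym γ≡d))
      ... | no _    = refl
      at-γ : s γ ^ (classSize cls γ ∸ 1) ≡ s γ * s γ ^ (classSize (cls ∘ suc) γ ∸ 1)
      at-γ with γ Fin.≟ γ | cls (suc zero) Fin.≟ γ
      ... | no γ≢γ | _        = ⊥-elim (γ≢γ refl)
      ... | yes _  | no ≢γ   = ⊥-elim (≢γ (sym same))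
      ... | yes _  | yes _    = refl

    onto-merge : Onto cls → Onto (cls ∘ suc)
    onto-merge onto d with onto d
    ... | zero  , γ≡d = zero , trans (sym same) γ≡d
    ... | suc r , c≡d = r , c≡d

    factorsThroughQuotient-merge : FactorsThroughQuotient (cls ∘ suc) (mergeFront w) → FactorsThroughQuotient cls w
    factorsThroughQuotient-merge factors = begin
      det X                                                            ≡⟨ det-classMatrix-merge ⟩
      s γ * det (classMatrix (cls ∘ suc) (mergeFront w))               ≡⟨ cong (s γ *_) factors ⟩
      s γ * (classFactor (cls ∘ suc) * det (quotientMatrix (cls ∘ suc) (mergeFront w)))
        ≡⟨ sym (ℤP.*-assoc (s γ) _ _) ⟩
      s γ * classFactor (cls ∘ suc) * det (quotientMatrix (cls ∘ suc) (mergeFront w))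
        ≡⟨ cong₂ _*_ (sym classFactor-merge) (det-cong quotientMatrix-merge) ⟩
      classFactor cls * det (quotientMatrix cls w)                     ∎
      where open ≡-Reasoning

  factorsThroughQuotient-bijective : ∀ {n} (cls : Fin n → Fin m) w → Injective _≡_ _≡_ cls → Onto cls →
    FactorsThroughQuotient cls w
  factorsThroughQuotient-bijective {n} cls w cls-inj onto = begin
    det (classMatrix cls w)
      ≡⟨ det-cong entries ⟩
    det (λ r c → quotientMatrix cls w (cls r) (cls c))
      ≡⟨ det-conj-injective n≡m cls cls-inj (quotientMatrix cls w) ⟩
    det (quotientMatrix cls w)
      ≡⟨ sym (ℤP.*-identityˡ _) ⟩
    + 1 * det (quotientMatrix cls w)
      ≡⟨ cong (_* det (quotientMatrix cls w)) (sym classFactor≡1) ⟩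
    classFactor cls * det (quotientMatrix cls w) ∎
    where
    open ≡-Reasoning
    section : Fin m → Fin n
    section d = proj₁ (onto d)
    section-inj : Injective _≡_ _≡_ section
    section-inj {d} {e} eq = trans (sym (proj₂ (onto d))) (trans (cong cls eq) (proj₂ (onto e)))
    n≡m : n ≡ m
    n≡m = cantor-schröder-bernstein cls-inj section-inj
    weight : ∀ v → classWeight cls w (cls v) ≡ w v
    weight v = trans (sumFin-single _ v (λ u u≢v → δ-≢ (w u) (u≢v ∘ cls-inj))) (δ-≡ (w v) refl)
    entries : ∀ r c → classMatrix cls w r c ≡ quotientMatrix cls w (cls r) (cls c)
    entries r c =
      cong₂ _-_ (δ-reflects (s (cls r)) (cong cls) cls-inj) (cong (B (cls r) (cls c) *_) (sym (weight c)))
    classFactor≡1 : classFactor cls ≡ + 1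
    classFactor≡1 = prodFin-one _ λ d → cong (λ k → s d ^ (k ∸ 1))
      (trans (sumℕ-single _ (section d) λ v v≢ → indicator-≢ λ eq → v≢ (cls-inj (trans eq (sym (proj₂ (onto d))))))
             (indicator-≡ (proj₂ (onto d))))

  SharedClass : ∀ {n} → (Fin n → Fin m) → Set
  SharedClass {n} cls = Σ (Fin n) λ u → Σ (Fin n) λ u′ → u ≢ u′ × cls u ≡ cls u′

  sharedClass? : ∀ {n} (cls : Fin n → Fin m) → Dec (SharedClass cls)
  sharedClass? cls = any? λ u → any? λ u′ → ¬? (u Fin.≟ u′) ×-dec (cls u Fin.≟ cls u′)

  ¬sharedClass⇒injective : ∀ {n} (cls : Fin n → Fin m) → ¬ SharedClass cls → Injective _≡_ _≡_ cls
  ¬sharedClass⇒injective cls none {u} {u′} same with u Fin.≟ u′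
  ... | yes u≡u′ = u≡u′
  ... | no u≢u′ = ⊥-elim (none (u , u′ , u≢u′ , same))

  onto-permute : ∀ {n} (cls : Fin n → Fin m) (π : Permutation′ n) → Onto cls → Onto (cls ∘ (π ⟨$⟩ʳ_))
  onto-permute cls π onto d = π ⟨$⟩ˡ proj₁ (onto d) , trans (cong cls (Perm.inverseʳ π)) (proj₂ (onto d))

  -- sends 0 to u and 1 to u′
  toFront : ∀ {n} {u u′ : Fin (suc (suc n))} → u ≢ u′ → Permutation′ (suc (suc n))
  toFront {u = u} u≢u′ = Perm.insert zero u (Perm.insert zero (punchOut u≢u′) Perm.id)

  factorsThroughQuotient-step : ∀ {n} (cls : Fin (suc (suc n)) → Fin m) w → Onto cls → Dec (SharedClass cls) →
    (∀ (cls′ : Fin (suc n) → Fin m) w′ → Onto cls′ → FactorsThroughQuotient cls′ w′) →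
    FactorsThroughQuotient cls w
  factorsThroughQuotient-step cls w onto (no none) factors =
    factorsThroughQuotient-bijective cls w (¬sharedClass⇒injective cls none) onto
  factorsThroughQuotient-step cls w onto (yes (u , u′ , u≢u′ , same)) factors =
    factorsThroughQuotient-reindex σ σ-inj cls w
      (factorsThroughQuotient-merge (cls ∘ σ) (w ∘ σ) same′
        (factors (cls ∘ σ ∘ suc) (mergeFront (w ∘ σ))
          (onto-merge (cls ∘ σ) (w ∘ σ) same′ (onto-permute cls (toFront u≢u′) onto))))
    where
    σ = toFront u≢u′ ⟨$⟩ʳ_
    σ-inj : Injective _≡_ _≡_ σ
    σ-inj = Injection.injective (↔⇒↣ (toFront u≢u′))
    same′ : cls (σ zero) ≡ cls (σ (suc zero))
    same′ = trans same (cong cls (sym (punchIn-punchOut u≢u′)))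

  det-classMatrix-factors : ∀ {n} (cls : Fin n → Fin m) w → Onto cls → FactorsThroughQuotient cls w
  det-classMatrix-factors {zero}        cls w onto = factorsThroughQuotient-bijective cls w (λ { {()} }) onto
  det-classMatrix-factors {suc zero}    cls w onto =
    factorsThroughQuotient-bijective cls w (λ { {zero} {zero} _ → refl }) onto
  det-classMatrix-factors {suc (suc n)} cls w onto =
    factorsThroughQuotient-step cls w onto (sharedClass? cls) det-classMatrix-factors

-- Graph distances

any-tabulate-true : ∀ {A : Set} {n} (g : Fin n → A) (p : A → Bool) i → p (g i) ≡ true →
  any p (tabulate g) ≡ true
any-tabulate-true g p zero    pgi rewrite pgi = refl
any-tabulate-true g p (suc i) pgi rewrite any-tabulate-true (g ∘ suc) p i pgi = ∨-zeroʳ (p (g zero))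

any-tabulate-false : ∀ {A : Set} {n} (g : Fin n → A) (p : A → Bool) → (∀ i → p (g i) ≡ false) →
  any p (tabulate g) ≡ false
any-tabulate-false {n = zero}  g p pg≡ = refl
any-tabulate-false {n = suc n} g p pg≡ rewrite pg≡ zero = any-tabulate-false (g ∘ suc) p (pg≡ ∘ suc)

does-true : ∀ {P : Set} (d : Dec P) → P → ⌊ d ⌋ ≡ true
does-true (yes _) p = refl
does-true (no ¬p) p = ⊥-elim (¬p p)

does-false : ∀ {P : Set} (d : Dec P) → ¬ P → ⌊ d ⌋ ≡ false
does-false (yes p) ¬p = ⊥-elim (¬p p)
does-false (no _)  ¬p = refl

minFrom-suc : ∀ p s f → minFrom p (suc s) f ≡ suc (minFrom (p ∘ suc) s f)
minFrom-suc p s zero    = refl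
minFrom-suc p s (suc f) with p (suc s)
... | true  = refl
... | false = minFrom-suc p (suc s) f

minFrom-first : ∀ {p} m {f} → m < f → (∀ i → i < m → p i ≡ false) → p m ≡ true → minFrom p 0 f ≡ m
minFrom-first {p} zero {suc f} _ _ p₀ rewrite p₀ = refl
minFrom-first {p} (suc m) {suc f} (s≤s m<f) below pm rewrite below 0 (s≤s z≤n) =
  trans (minFrom-suc p 0 f) (cong suc (minFrom-first m m<f (λ i i<m → below (suc i) (s≤s i<m)) pm))

distinct⇒2≤ : ∀ {n} {u v : Fin n} → u ≢ v → 2 ≤ n
distinct⇒2≤ {suc zero}    {zero} {zero} u≢v = ⊥-elim (u≢v refl)
distinct⇒2≤ {suc (suc n)} _                 = s≤s (s≤s z≤n)

distinct⇒3≤ : ∀ {n} {u v w : Fin n} → u ≢ v → w ≢ u → w ≢ v → 3 ≤ n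
distinct⇒3≤ {suc n} u≢v w≢u w≢v = s≤s (distinct⇒2≤ λ eq → u≢v (punchOut-injective w≢u w≢v eq))

module Distance {n : ℕ} (A : Fin n → Fin n → Bool) where

  reach₁-adjacent : ∀ {u v} → A u v ≡ true → reach A 1 u v ≡ true
  reach₁-adjacent {u} {v} Auv
    rewrite any-tabulate-true id (λ w → reach A 0 u w ∧ A w v) u
              (trans (cong (_∧ A u v) (does-true (u Fin.≟ u) refl)) Auv) = ∨-zeroʳ _

  reach₁-nonadjacent : ∀ {u v} → u ≢ v → A u v ≡ false → reach A 1 u v ≡ false
  reach₁-nonadjacent {u} {v} u≢v Auv rewrite does-false (u Fin.≟ v) u≢v = any-tabulate-false id _ step
    where
    step : ∀ w → (⌊ u Fin.≟ w ⌋ ∧ A w v) ≡ false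
    step w with u Fin.≟ w
    ... | yes refl = Auv
    ... | no _     = refl

  reach₂-common : ∀ {u v} w → A u w ≡ true → A w v ≡ true → reach A 2 u v ≡ true
  reach₂-common {u} {v} w Auw Awv
    rewrite any-tabulate-true id (λ x → reach A 1 u x ∧ A x v) w
              (trans (cong (_∧ A w v) (reach₁-adjacent Auw)) Awv) = ∨-zeroʳ _

  dist-refl : ∀ u → dist A u u ≡ 0
  dist-refl u = minFrom-first {λ m → reach A m u u} 0 (nonEmpty u) (λ _ ()) (does-true (u Fin.≟ u) refl)
    where
    nonEmpty : ∀ {n} → Fin n → 0 < n
    nonEmpty zero    = s≤s z≤n
    nonEmpty (suc _) = s≤s z≤n

  dist-adjacent : ∀ {u v} → u ≢ v → A u v ≡ true → dist A u v ≡ 1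
  dist-adjacent {u} {v} u≢v Auv = minFrom-first 1 (distinct⇒2≤ u≢v)
    (λ { zero _ → does-false (u Fin.≟ v) u≢v ; (suc _) (s≤s ()) }) (reach₁-adjacent Auv)

  dist-two : ∀ {u v} w → u ≢ v → w ≢ u → w ≢ v →
    A u v ≡ false → A u w ≡ true → A w v ≡ true → dist A u v ≡ 2
  dist-two {u} {v} w u≢v w≢u w≢v Auv Auw Awv = minFrom-first 2 (distinct⇒3≤ u≢v w≢u w≢v)
    (λ { zero _ → does-false (u Fin.≟ v) u≢v
       ; (suc zero) _ → reach₁-nonadjacent u≢v Auv
       ; (suc (suc _)) (s≤s (s≤s ())) })
    (reach₂-common w Auw Awv)

maxFin-lub : ∀ {n} (f : Fin n → ℕ) {b} → (∀ u → f u ≤ b) → maxFin f ≤ b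
maxFin-lub {zero}  f f≤b = z≤n
maxFin-lub {suc n} f f≤b = ℕP.⊔-lub (f≤b zero) (maxFin-lub (f ∘ suc) (f≤b ∘ suc))

maxFin-attained : ∀ {n} (f : Fin n → ℕ) {b} → (∀ u → f u ≤ b) → ∀ u → f u ≡ b → maxFin f ≡ b
maxFin-attained {suc n} f f≤b zero    fu≡b =
  trans (cong (_⊔ maxFin (f ∘ suc)) fu≡b) (ℕP.m≥n⇒m⊔n≡m (maxFin-lub (f ∘ suc) (f≤b ∘ suc)))
maxFin-attained {suc n} f f≤b (suc u) fu≡b =
  trans (cong (f zero ⊔_) (maxFin-attained (f ∘ suc) (f≤b ∘ suc) u fu≡b)) (ℕP.m≤n⇒m⊔n≡n (f≤b zero))

sumFin-one : ∀ n → sumFin {n} (λ _ → + 1) ≡ + n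
sumFin-one zero    = refl
sumFin-one (suc n) = cong (_+_ (+ 1)) (sumFin-one n)

-- The k-coalescence

anotherIndex : ∀ {l} → 2 ≤ l → Fin l → Fin l
anotherIndex (s≤s (s≤s _)) zero    = suc zero
anotherIndex (s≤s (s≤s _)) (suc _) = zero

anotherIndex-≢ : ∀ {l} (2≤l : 2 ≤ l) i → anotherIndex 2≤l i ≢ i
anotherIndex-≢ (s≤s (s≤s _)) zero    ()
anotherIndex-≢ (s≤s (s≤s _)) (suc _) ()

module Coalescence (k l : ℕ) (a : Fin l → ℕ) (2≤l : 2 ≤ l) (1≤k : 1 ≤ k) (k<a : ∀ i → k < a i) where

  V : Set
  V = CoalVertex k l a

  part : V → Fin (suc l)
  part (inj₁ _)       = zero
  part (inj₂ (i , _)) = suc i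

  -- the distance between distinct vertices (the value 1 for x = y is junk)
  coalDist : V → V → ℕ
  coalDist (inj₁ _)       _              = 1
  coalDist (inj₂ _)       (inj₁ _)       = 1
  coalDist (inj₂ (i , _)) (inj₂ (j , _)) = if ⌊ i Fin.≟ j ⌋ then 1 else 2

  coalEcc : V → ℕ
  coalEcc (inj₁ _) = 1
  coalEcc (inj₂ _) = 2

  coalDist≤coalEcc : ∀ x y → coalDist x y ≤ coalEcc y
  coalDist≤coalEcc (inj₁ _)       (inj₁ _) = s≤s z≤n
  coalDist≤coalEcc (inj₁ _)       (inj₂ _) = s≤s z≤n
  coalDist≤coalEcc (inj₂ _)       (inj₁ _) = s≤s z≤n
  coalDist≤coalEcc (inj₂ (i , _)) (inj₂ (j , _)) with ⌊ i Fin.≟ j ⌋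
  ... | true  = s≤s z≤n
  ... | false = s≤s (s≤s z≤n)

  pick : ∀ i → Fin (a i ∸ k)
  pick i = Fin.fromℕ< (ℕP.m<n⇒0<n∸m (k<a i))

  farthest : V → V
  farthest (inj₁ _)       = inj₂ (i₀ , pick i₀)
    where
    i₀ = Fin.fromℕ< 2≤l
  farthest (inj₂ (i , _)) = inj₂ (other , pick other)
    where
    other = anotherIndex 2≤l i

  farthest-≢ : ∀ y → farthest y ≢ y
  farthest-≢ (inj₁ _)       ()
  farthest-≢ (inj₂ (i , _)) eq = anotherIndex-≢ 2≤l i (cong index eq)
    where
    index : V → Fin l
    index (inj₁ _)       = i
    index (inj₂ (j , _)) = j

  coalDist-farthest : ∀ y → coalDist (farthest y) y ≡ coalEcc y
  coalDist-farthest (inj₁ _)       = refl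
  coalDist-farthest (inj₂ (i , _)) =
    cong (λ b → if b then 1 else 2) (does-false (anotherIndex 2≤l i Fin.≟ i) (anotherIndex-≢ 2≤l i))

  partInteraction : Fin (suc l) → Fin (suc l) → ℤ
  partInteraction zero    _       = + 1
  partInteraction (suc i) zero    = + 1
  partInteraction (suc i) (suc j) = if ⌊ i Fin.≟ j ⌋ then + 0 else + 2

  eccEntry : ℕ → ℕ → ℕ → ℤ
  eccEntry d e e′ = if ⌊ d ℕ.≟ e ⊓ e′ ⌋ then + d else + 0

  -- Two vertices of the same P i are adjacent, but both have eccentricity 2: that entry of ε(G) is 0.
  eccEntry-coal : ∀ x y → eccEntry (coalDist x y) (coalEcc x) (coalEcc y) ≡ partInteraction (part x) (part y)
  eccEntry-coal (inj₁ _)       (inj₁ _) = refl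
  eccEntry-coal (inj₁ _)       (inj₂ _) = refl
  eccEntry-coal (inj₂ _)       (inj₁ _) = refl
  eccEntry-coal (inj₂ (i , _)) (inj₂ (j , _)) with ⌊ i Fin.≟ j ⌋
  ... | true  = refl
  ... | false = refl

  sumV : (V → ℤ) → ℤ
  sumV G = sumFin (G ∘ inj₁) + sumFin (λ i → sumFin (λ x → G (inj₂ (i , x))))

  sumV-cong : ∀ {G H : V → ℤ} → (∀ x → G x ≡ H x) → sumV G ≡ sumV H
  sumV-cong G≗H =
    cong₂ _+_ (sumFin-cong (G≗H ∘ inj₁)) (sumFin-cong λ i → sumFin-cong λ x → G≗H (inj₂ (i , x)))

  sumV-single : ∀ (G : V → ℤ) y → (∀ x → x ≢ y → G x ≡ + 0) → sumV G ≡ G y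
  sumV-single G (inj₁ c) G≗0 =
    trans (cong₂ _+_ (sumFin-single (G ∘ inj₁) c (λ c′ c′≢c → G≗0 (inj₁ c′) (c′≢c ∘ inj₁-injective)))
                     (sumFin-zero _ λ i → sumFin-zero _ λ x → G≗0 (inj₂ (i , x)) λ ()))
          (ℤP.+-identityʳ (G (inj₁ c)))
    where
    inj₁-injective : ∀ {c c′ : Fin k} → _≡_ {A = V} (inj₁ c′) (inj₁ c) → c′ ≡ c
    inj₁-injective refl = refl
  sumV-single G (inj₂ (i , z)) G≗0 =
    trans (cong₂ _+_ (sumFin-zero _ λ c → G≗0 (inj₁ c) λ ())
                     (trans (sumFin-single _ i λ j j≢i → sumFin-zero _ λ x → G≗0 (inj₂ (j , x)) (j≢i ∘ cong part′))
                            (sumFin-single _ z λ x x≢z → G≗0 (inj₂ (i , x)) (x≢z ∘ inj₂-injective))))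
          (ℤP.+-identityˡ (G (inj₂ (i , z))))
    where
    part′ : V → Fin l
    part′ (inj₁ _)       = i
    part′ (inj₂ (j , _)) = j
    inj₂-injective : ∀ {x} → _≡_ {A = V} (inj₂ (i , x)) (inj₂ (i , z)) → x ≡ z
    inj₂-injective refl = refl

  sumV-sumFin-comm : ∀ {n} (H : Fin n → V → ℤ) →
    sumV (λ x → sumFin (λ v → H v x)) ≡ sumFin (λ v → sumV (H v))
  sumV-sumFin-comm H = begin
    sumV (λ x → sumFin (λ v → H v x))
      ≡⟨ cong₂ _+_ (sym (sumFin-comm (λ v c → H v (inj₁ c))))
                   (trans (sumFin-cong (λ i → sym (sumFin-comm (λ v x → H v (inj₂ (i , x))))))
                          (sym (sumFin-comm (λ v i → sumFin (λ x → H v (inj₂ (i , x))))))) ⟩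
    sumFin (λ v → sumFin (H v ∘ inj₁)) + sumFin (λ v → sumFin (λ i → sumFin (λ x → H v (inj₂ (i , x)))))
      ≡⟨ sym (sumFin-distrib-+ (λ v → sumFin (H v ∘ inj₁))
                               (λ v → sumFin (λ i → sumFin (λ x → H v (inj₂ (i , x)))))) ⟩
    sumFin (λ v → sumV (H v)) ∎
    where open ≡-Reasoning

  partSize : Fin (suc l) → ℕ
  partSize zero    = k
  partSize (suc j) = a j ∸ k

  eccEntry-zero : ∀ e e′ → eccEntry 0 e e′ ≡ + 0
  eccEntry-zero e e′ with ⌊ 0 ℕ.≟ e ⊓ e′ ⌋
  ... | true  = refl
  ... | false = refl

  module Labelled {n : ℕ} (φ : Fin n ↔ V) where

    to : Fin n → V
    to = Inverse.to φ

    from : V → Fin n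
    from = Inverse.from φ

    to-from : ∀ x → to (from x) ≡ x
    to-from x = Inverse.inverseˡ φ refl

    from-to : ∀ v → from (to v) ≡ v
    from-to v = Inverse.inverseʳ φ refl

    to-injective : Injective _≡_ _≡_ to
    to-injective = Injection.injective (↔⇒↣ φ)

    adj : Fin n → Fin n → Bool
    adj u v = coalAdj (to u) (to v)

    cls : Fin n → Fin (suc l)
    cls = part ∘ to

    open Distance adj

    dist-coal : ∀ {u v} → u ≢ v → dist adj u v ≡ coalDist (to u) (to v)
    dist-coal {u} {v} u≢v with to u in eu | to v in ev
    ... | inj₁ c | inj₁ c′ =
      dist-adjacent u≢v
        (trans (cong₂ coalAdj eu ev) (cong not (does-false (c Fin.≟ c′) (tu≢tv ∘ cong inj₁))))
      where
      tu≢tv : inj₁ c ≢ inj₁ c′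
      tu≢tv eq = u≢v (to-injective (trans eu (trans eq (sym ev))))
    ... | inj₁ _ | inj₂ _ = dist-adjacent u≢v (cong₂ coalAdj eu ev)
    ... | inj₂ _ | inj₁ _ = dist-adjacent u≢v (cong₂ coalAdj eu ev)
    ... | inj₂ (i , x) | inj₂ (j , y) with i Fin.≟ j
    ...   | yes refl = dist-adjacent u≢v (trans (cong₂ coalAdj eu ev)
                         (cong₂ _∧_ (does-true (i Fin.≟ i) refl)
                                    (cong not (does-false (toℕ x ℕ.≟ toℕ y) (x≢y ∘ toℕ-injective)))))
      where
      x≢y : x ≢ y
      x≢y x≡y = u≢v (to-injective (trans eu (trans (cong (λ z → inj₂ (i , z)) x≡y) (sym ev))))
    ...   | no i≢j = dist-two centre u≢v (core≢part eu) (core≢part ev)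
                       (trans (cong₂ coalAdj eu ev) (cong (_∧ _) (does-false (i Fin.≟ j) i≢j)))
                       (cong₂ coalAdj eu (to-from _)) (cong₂ coalAdj (to-from _) ev)
      where
      centre : Fin n
      centre = from (inj₁ (Fin.fromℕ< 1≤k))
      core≢part : ∀ {w z} → to w ≡ inj₂ z → centre ≢ w
      core≢part tw≡ centre≡w with trans (sym (to-from _)) (trans (cong to centre≡w) tw≡)
      ... | ()

    ecc-coal : ∀ v → ecc adj v ≡ coalEcc (to v)
    ecc-coal v = maxFin-attained (λ u → dist adj u v) bound (from (farthest (to v))) (begin
      dist adj (from (farthest (to v))) v     ≡⟨ dist-coal far≢v ⟩
      coalDist (to (from (farthest (to v)))) (to v) ≡⟨ cong (λ x → coalDist x (to v)) (to-from _) ⟩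
      coalDist (farthest (to v)) (to v)       ≡⟨ coalDist-farthest (to v) ⟩
      coalEcc (to v)                          ∎)
      where
      open ≡-Reasoning
      far≢v : from (farthest (to v)) ≢ v
      far≢v eq = farthest-≢ (to v) (trans (sym (to-from _)) (cong to eq))
      bound : ∀ u → dist adj u v ≤ coalEcc (to v)
      bound u with u Fin.≟ v
      ... | yes refl = ℕP.≤-trans (ℕP.≤-reflexive (dist-refl u)) z≤n
      ... | no u≢v  = ℕP.≤-trans (ℕP.≤-reflexive (dist-coal u≢v)) (coalDist≤coalEcc (to u) (to v))

    eccMatrix-offDiagonal : ∀ {u v} → u ≢ v → eccMatrix adj u v ≡ partInteraction (cls u) (cls v)
    eccMatrix-offDiagonal {u} {v} u≢v = begin
      eccEntry (dist adj u v) (ecc adj u) (ecc adj v)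
        ≡⟨ cong₂ (λ d e → eccEntry d e (ecc adj v)) (dist-coal u≢v) (ecc-coal u) ⟩
      eccEntry (coalDist (to u) (to v)) (coalEcc (to u)) (ecc adj v)
        ≡⟨ cong (eccEntry (coalDist (to u) (to v)) (coalEcc (to u))) (ecc-coal v) ⟩
      eccEntry (coalDist (to u) (to v)) (coalEcc (to u)) (coalEcc (to v))
        ≡⟨ eccEntry-coal (to u) (to v) ⟩
      partInteraction (cls u) (cls v) ∎
      where open ≡-Reasoning

    eccMatrix-diagonal : ∀ u → eccMatrix adj u u ≡ + 0
    eccMatrix-diagonal u = trans (cong (λ d → eccEntry d (ecc adj u) (ecc adj u)) (dist-refl u))
                                 (eccEntry-zero (ecc adj u) (ecc adj u))

    sumFin-to : ∀ (G : V → ℤ) → sumFin (G ∘ to) ≡ sumV G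
    sumFin-to G = begin
      sumFin (G ∘ to)
        ≡⟨ sumFin-cong (λ v → sym (trans (sumV-single (H v) (to v) (H-off v)) (δ-≡ (G (to v)) (sym (from-to v))))) ⟩
      sumFin (λ v → sumV (H v))
        ≡⟨ sym (sumV-sumFin-comm H) ⟩
      sumV (λ x → sumFin (λ v → H v x))
        ≡⟨ sumV-cong (λ x → trans (sumFin-single (λ v → H v x) (from x) (H-off′ x)) (δ-≡ (G x) refl)) ⟩
      sumV G ∎
      where
      open ≡-Reasoning
      H : Fin n → V → ℤ
      H v x = δ v (from x) (G x)
      H-off : ∀ v x → x ≢ to v → H v x ≡ + 0
      H-off v x x≢ = δ-≢ (G x) λ v≡ → x≢ (trans (sym (to-from x)) (cong to (sym v≡)))
      H-off′ : ∀ x v → v ≢ from x → H v x ≡ + 0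
      H-off′ x v v≢ = δ-≢ (G x) v≢

    +-classSize : ∀ d → + classSize cls d ≡ sumV (λ x → + indicator (part x) d)
    +-classSize d = trans (+-sumℕ (λ v → indicator (cls v) d)) (sumFin-to (λ x → + indicator (part x) d))

    classSize-core : classSize cls zero ≡ k
    classSize-core = ℤP.+-injective (begin
      + classSize cls zero
        ≡⟨ +-classSize zero ⟩
      sumFin {k} (λ _ → + 1) + sumFin (λ i → sumFin (zeros i))
        ≡⟨ cong₂ _+_ (sumFin-one k) (sumFin-zero _ λ i → sumFin-zero (zeros i) λ _ → refl) ⟩
      + k + + 0
        ≡⟨ ℤP.+-identityʳ (+ k) ⟩
      + k ∎)
      where
      open ≡-Reasoning
      zeros : ∀ i → Fin (a i ∸ k) → ℤ
      zeros i _ = + 0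

    classSize-part : ∀ j → classSize cls (suc j) ≡ a j ∸ k
    classSize-part j = ℤP.+-injective (begin
      + classSize cls (suc j)
        ≡⟨ +-classSize (suc j) ⟩
      sumFin {k} (λ _ → + 0) + sumFin (λ i → sumFin (inP i))
        ≡⟨ cong₂ _+_ (sumFin-zero {k} _ λ _ → refl) (sumFin-single (sumFin ∘ inP) j outside) ⟩
      + 0 + sumFin (inP j)
        ≡⟨ ℤP.+-identityˡ _ ⟩
      sumFin (inP j)
        ≡⟨ sumFin-cong {a j ∸ k} (λ _ → cong +_ (indicator-≡ {u = suc j} refl)) ⟩
      sumFin {a j ∸ k} (λ _ → + 1)
        ≡⟨ sumFin-one (a j ∸ k) ⟩
      + (a j ∸ k) ∎)
      where
      open ≡-Reasoning
      inP : ∀ i → Fin (a i ∸ k) → ℤ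
      inP i _ = + indicator (suc i) (suc j)
      outside : ∀ i → i ≢ j → sumFin (inP i) ≡ + 0
      outside i i≢j = sumFin-zero (inP i) λ _ → cong +_ (indicator-≢ (i≢j ∘ suc-injective))

    classSize-cls : ∀ d → classSize cls d ≡ partSize d
    classSize-cls zero    = classSize-core
    classSize-cls (suc j) = classSize-part j

    cls-onto : Onto cls
    cls-onto zero    = from (inj₁ (Fin.fromℕ< 1≤k)) , cong part (to-from _)
    cls-onto (suc i) = from (inj₂ (i , pick i)) , cong part (to-from _)

    module AtPoint (t : ℤ) where

      shift : Fin (suc l) → ℤ
      shift zero    = t + + 1
      shift (suc _) = t

      open ClassMatrix shift partInteraction

      charMatrix-offDiagonal : ∀ {u v} → u ≢ v →
        δ u v t - eccMatrix adj u v ≡ classMatrix cls (λ _ → + 1) u v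
      charMatrix-offDiagonal {u} {v} u≢v = begin
        δ u v t - eccMatrix adj u v
          ≡⟨ cong₂ _-_ (δ-≢ t u≢v) (eccMatrix-offDiagonal u≢v) ⟩
        + 0 - partInteraction (cls u) (cls v)
          ≡⟨ cong (λ x → + 0 - x) (sym (ℤP.*-identityʳ (partInteraction (cls u) (cls v)))) ⟩
        + 0 - partInteraction (cls u) (cls v) * + 1
          ≡⟨ cong (_- partInteraction (cls u) (cls v) * + 1) (sym (δ-≢ (shift (cls u)) u≢v)) ⟩
        classMatrix cls (λ _ → + 1) u v ∎
        where open ≡-Reasoning

      charMatrix-diagonal : ∀ u → δ u u t - eccMatrix adj u u ≡ classMatrix cls (λ _ → + 1) u u
      charMatrix-diagonal u = begin
        δ u u t - eccMatrix adj u u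
          ≡⟨ cong₂ _-_ (δ-≡ {u = u} t refl) (eccMatrix-diagonal u) ⟩
        t - + 0
          ≡⟨ diagonal (cls u) ⟩
        shift (cls u) - partInteraction (cls u) (cls u) * + 1
          ≡⟨ cong (_- partInteraction (cls u) (cls u) * + 1) (sym (δ-≡ {u = u} (shift (cls u)) refl)) ⟩
        classMatrix cls (λ _ → + 1) u u ∎
        where
        open ≡-Reasoning
        shift-back : ∀ t → t - + 0 ≡ (t + + 1) - + 1 * + 1
        shift-back = solve-∀
        diagonal : ∀ d → t - + 0 ≡ shift d - partInteraction d d * + 1
        diagonal zero    = shift-back t
        diagonal (suc i) = cong (λ b → t - (if b then + 0 else + 2) * + 1) (sym (does-true (i Fin.≟ i) refl))

      charMatrix≡classMatrix : ∀ u v → δ u v t - eccMatrix adj u v ≡ classMatrix cls (λ _ → + 1) u v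
      charMatrix≡classMatrix u v = byCases (u Fin.≟ v)
        where
        byCases : Dec (u ≡ v) → δ u v t - eccMatrix adj u v ≡ classMatrix cls (λ _ → + 1) u v
        byCases (yes refl) = charMatrix-diagonal u
        byCases (no u≢v)  = charMatrix-offDiagonal u≢v

      quotientMatrix≡ : ∀ d e → quotientMatrix cls (λ _ → + 1) d e ≡ δ d e t - quotMatrix k l a d e
      quotientMatrix≡ d e =
        trans (cong (λ x → δ d e (shift d) - partInteraction d e * x)
                    (trans (classWeight-one cls e) (cong +_ (classSize-cls e))))
              (entry d e)
        where
        core : ∀ k → 1 ≤ k → (t + + 1) - + 1 * + k ≡ t - + (k ∸ 1)
        core (suc k′) _ = cancel t (+ k′)
          where
          cancel : ∀ t x → (t + + 1) - + 1 * (+ 1 + x) ≡ t - x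
          cancel = solve-∀
        entry : ∀ d e → δ d e (shift d) - partInteraction d e * + partSize e ≡ δ d e t - quotMatrix k l a d e
        entry zero    zero    = core k 1≤k
        entry zero    (suc j) = cong (λ x → + 0 - x) (ℤP.*-identityˡ (+ (a j ∸ k)))
        entry (suc i) zero    = cong (λ x → + 0 - x) (ℤP.*-identityˡ (+ k))
        entry (suc i) (suc j) with ⌊ i Fin.≟ j ⌋
        ... | true  = cong (_-_ (δ (suc i) (suc j) t)) (ℤP.*-zeroˡ (+ (a j ∸ k)))
        ... | false = cong (_-_ (δ (suc i) (suc j) t)) (sym (ℤP.pos-* 2 (a j ∸ k)))

      classFactor≡ : classFactor cls ≡ (t + + 1) ^ (k ∸ 1) * t ^ sumℕ (λ i → a i ∸ k ∸ 1)
      classFactor≡ = cong₂ _*_ (cong (λ c → (t + + 1) ^ (c ∸ 1)) (classSize-cls zero))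
        (trans (prodFin-cong (λ i → cong (λ c → t ^ (c ∸ 1)) (classSize-cls (suc i))))
               (prodFin-pow t (λ i → a i ∸ k ∸ 1)))

      charPolyAt-eccMatrix : charPolyAt (eccMatrix adj) t
        ≡ (t + + 1) ^ (k ∸ 1) * (t ^ sumℕ (λ i → a i ∸ k ∸ 1) * charPolyAt (quotMatrix k l a) t)
      charPolyAt-eccMatrix = begin
        charPolyAt (eccMatrix adj) t
          ≡⟨ det-cong charMatrix≡classMatrix ⟩
        det (classMatrix cls (λ _ → + 1))
          ≡⟨ det-classMatrix-factors cls (λ _ → + 1) cls-onto ⟩
        classFactor cls * det (quotientMatrix cls (λ _ → + 1))
          ≡⟨ cong₂ _*_ classFactor≡ (det-cong quotientMatrix≡) ⟩
        (t + + 1) ^ (k ∸ 1) * t ^ sumℕ (λ i → a i ∸ k ∸ 1) * charPolyAt (quotMatrix k l a) t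
          ≡⟨ ℤP.*-assoc ((t + + 1) ^ (k ∸ 1)) _ _ ⟩
        (t + + 1) ^ (k ∸ 1) * (t ^ sumℕ (λ i → a i ∸ k ∸ 1) * charPolyAt (quotMatrix k l a) t) ∎
        where open ≡-Reasoning

mainTheorem2 : (l k : ℕ) (a : Fin l → ℕ) →
    2 ≤ l → (∀ i → 3 ≤ a i) → 1 ≤ k → (∀ i → k < a i) →
    (n : ℕ) (φ : Fin n ↔ CoalVertex k l a) →
    let adj = λ u v → coalAdj (Inverse.to φ u) (Inverse.to φ v) in
    ∀ (t : ℤ) →
      charPolyAt (eccMatrix adj) t
        ≡ ((t + + 1) ^ (k ∸ 1)) * ((t ^ sumℕ (λ i → a i ∸ k ∸ 1))
            * charPolyAt (quotMatrix k l a) t)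
mainTheorem2 l k a 2≤l _ 1≤k k<a n φ t =
  Coalescence.Labelled.AtPoint.charPolyAt-eccMatrix k l a 2≤l 1≤k k<a φ t
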